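{- Over Bishop-style constructive mathematics, the following are equivalent: (UCT$_c$) Every function $f\colon[0,1]\to\mathbb{R}$ with a continuous modulus is uniformly continuous. (UCT$_c'$) Every function $f\colon[0,1]\to\mathbb{R}$ with a continuous ternary modulus is uniformly continuous.
   Context: The setting is constructive. Real numbers are regular sequences of rationals $\langle r_n\rangle$ with $|r_n-r_{n+1}|\le2^{ -(n+1)}$. Equality is $\langle r_n\rangle\simeq\langle q_n\rangle$ iff $\forall n\,|r_{n+1}-q_{n+1}|\le2^{ -n}$. Functions $[0,1]\to\mathbb{R}$ respect $\simeq$. Modulus: - Fix a bijective coding of $\mathbb{Q}$ by $\mathbb{N}$. Let $|[0,1]|$ be the set of regular sequences in $[0,1]$, viewed as a subset of $\mathbb{N}^{\mathbb{N}}$, with pointwise equality. - A modulus of $f$ is $g\colon\mathbb{N}\to|[0,1]|\to\mathbb{N}$ such that $\forall k\,\forall x,y\in[0,1]\,(|x-y|\le2^{ -g_k(x)}\to|f(x)-f(y)|\le2^{ -k})$. - It is continuous if each $g_k$ is pointwise continuous with respect to initial segments. Ternary modulus: - For $s\in\{0,1,2\}^*$, define $N(\langle\rangle)=1$ and $N(s*\langle i\rangle)=2N(s)+(i-1)$. - For $\alpha\in\{0,1,2\}^{\mathbb{N}}$, $\Phi(\alpha)=\langle2^{ -(n+1)}N(\overline{\alpha}n)\rangle_n$. - A ternary modulus of $f$ is $g\colon\mathbb{N}\to\{0,1,2\}^{\mathbb{N}}\to\mathbb{N}$ with $\forall k\,\forall\alpha\,\forall x\in[0,1]\,(|\Phi(\alpha)-x|\le2^{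 -g_k(\alpha)}\to|f(\Phi(\alpha))-f(x)|\le2^{ -k})$. - It is continuous if each $g_k$ is pointwise continuous on $\{0,1,2\}^{\mathbb{N}}$. Uniform continuity of $f$ means there is $\omega$ with $|x-y|\le2^{ -\omega(k)}\to|f(x)-f(y)|\le2^{ -k}$ for all $k,x,y$. -}

module Defs where

open import Data.Nat using (ℕ; zero; suc) renaming (_<_ to _<ℕ_)
open import Data.Fin using (Fin; zero; suc; toℕ)
open import Data.Integer using (+_)
open import Data.List using (List; []; _∷ʳ_; foldl)
open import Data.List.Properties using (foldl-∷ʳ)
open import Data.Rational using (ℚ; nonNegative; _/_; 0ℚ; 1ℚ; ½; _+_; _*_; _-_; -_; ∣_∣; _≤_; _≤?_)
open import Data.Rational.Properties
open import Data.Rational.Solver using (module +-*-Solver)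
open import Data.Product using (Σ; _×_; _,_; ∃; proj₁; proj₂)
open import Relation.Binary.PropositionalEquality using (_≡_; refl; sym; cong)
open import Relation.Nullary.Decidable using (toWitness)

pw : ℕ → ℚ
pw zero    = 1ℚ
pw (suc n) = ½ * pw n

Regular : (ℕ → ℚ) → Set
Regular r = ∀ n → ∣ r n - r (suc n) ∣ ≤ pw (suc n)

record ℝ : Set where
  constructor mkℝ
  field
    seq : ℕ → ℚ
    reg : Regular seq
open ℝ public

-- |x - y| ≤ c for regular sequences x, y and a rational constant c,
-- i.e. the real c - |x - y| (sequence c - |x_{n+1} - y_{n+1}|) is
-- nonnegative in Bishop's sense: each term is ≥ -2^{-n}.
DistLe : (ℕ → ℚ) → (ℕ → ℚ) → ℚ → Set
DistLe x y c = ∀ n → ∣ x (suc n) - y (suc n) ∣ ≤ c + pw n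

_≃ₛ_ : (ℕ → ℚ) → (ℕ → ℚ) → Set
r ≃ₛ q = ∀ n → ∣ r (suc n) - q (suc n) ∣ ≤ pw n

-- |[0,1]| : regular sequences of rationals in [0,1]
-- (a subset of Baire space, rationals standing in for their codes)

record I01 : Set where
  constructor mkI
  field
    pt      : ℕ → ℚ
    pt-reg  : Regular pt
    pt-unit : ∀ n → (0ℚ ≤ pt n) × (pt n ≤ 1ℚ)
open I01 public

record Fun : Set where
  constructor mkFun
  field
    ap   : I01 → ℝ
    respects : ∀ x y → pt x ≃ₛ pt y → seq (ap x) ≃ₛ seq (ap y)
open Fun public

IsModulus : Fun → (ℕ → I01 → ℕ) → Set
IsModulus f g = ∀ k (x y : I01) →
  DistLe (pt x) (pt y) (pw (g k x)) →
  DistLe (seq (ap f x)) (seq (ap f y)) (pw k)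

IsContinuousModulus : (ℕ → I01 → ℕ) → Set
IsContinuousModulus g = ∀ k (x : I01) → ∃ λ m → ∀ (y : I01) →
  (∀ i → i <ℕ m → pt x i ≡ pt y i) → g k x ≡ g k y

Ternary : Set
Ternary = ℕ → Fin 3

initSeg : Ternary → ℕ → List (Fin 3)
initSeg α zero    = []
initSeg α (suc n) = initSeg α n ∷ʳ α n

digit : Fin 3 → ℚ
digit i = (+ toℕ i / 1) - 1ℚ

N : List (Fin 3) → ℚ
N = foldl (λ a i → (+ 2 / 1) * a + digit i) 1ℚ

Φseq : Ternary → ℕ → ℚ
Φseq α n = pw (suc n) * N (initSeg α n)

private
  open ≤-Reasoning
  open +-*-Solver

  pw-nonneg : ∀ n → 0ℚ ≤ pw n
  pw-nonneg zero    = toWitness {a? = 0ℚ ≤? 1ℚ} _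
  pw-nonneg (suc n) = begin
    0ℚ          ≡⟨ sym (*-zeroʳ ½) ⟩
    ½ * 0ℚ      ≤⟨ *-monoˡ-≤-nonNeg ½ {{_}} (pw-nonneg n) ⟩
    ½ * pw n    ∎

  halves : ∀ p → ½ * p + ½ * p ≡ p
  halves p = begin-equality
    ½ * p + ½ * p  ≡⟨ solve 2 (λ h x → h :* x :+ h :* x := (h :+ h) :* x) refl ½ p ⟩
    (½ + ½) * p    ≡⟨ *-identityˡ p ⟩
    p              ∎

  step : ∀ α n → Φseq α (suc n) ≡ Φseq α n + digit (α n) * pw (suc (suc n))
  step α n = begin-equality
    Φseq α (suc n)  ≡⟨ cong (pw (suc (suc n)) *_) (foldl-∷ʳ _ 1ℚ (α n) (initSeg α n)) ⟩
    (½ * P) * ((+ 2 / 1) * a + e)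
      ≡⟨ solve 4 (λ h p a e → (h :* p) :* (con (+ 2 / 1) :* a :+ e)
                   := (con (+ 2 / 1) :* h) :* (p :* a) :+ e :* (h :* p)) refl ½ P a e ⟩
    ((+ 2 / 1) * ½) * (P * a) + e * (½ * P)
      ≡⟨ cong (_+ e * (½ * P)) (*-identityˡ (P * a)) ⟩
    P * a + e * (½ * P) ∎
    where
    P = pw (suc n)
    a = N (initSeg α n)
    e = digit (α n)

  digit-lo : ∀ i → - 1ℚ ≤ digit i
  digit-lo zero             = toWitness {a? = - 1ℚ ≤? digit zero} _
  digit-lo (suc zero)       = toWitness {a? = - 1ℚ ≤? digit (suc zero)} _
  digit-lo (suc (suc zero)) = toWitness {a? = - 1ℚ ≤? digit (suc (suc zero))} _

  digit-hi : ∀ i → digit i ≤ 1ℚ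
  digit-hi zero             = toWitness {a? = digit zero ≤? 1ℚ} _
  digit-hi (suc zero)       = toWitness {a? = digit (suc zero) ≤? 1ℚ} _
  digit-hi (suc (suc zero)) = toWitness {a? = digit (suc (suc zero)) ≤? 1ℚ} _

  digit-abs : ∀ i → ∣ digit i ∣ ≤ 1ℚ
  digit-abs zero             = toWitness {a? = ∣ digit zero ∣ ≤? 1ℚ} _
  digit-abs (suc zero)       = toWitness {a? = ∣ digit (suc zero) ∣ ≤? 1ℚ} _
  digit-abs (suc (suc zero)) = toWitness {a? = ∣ digit (suc (suc zero)) ∣ ≤? 1ℚ} _

  half-le : ∀ p → 0ℚ ≤ p → ½ * p ≤ p
  half-le p 0≤p = begin
    ½ * p             ≡⟨ sym (+-identityʳ (½ * p)) ⟩
    ½ * p + 0ℚ        ≤⟨ +-monoʳ-≤ (½ * p) (pw-nonneg-like) ⟩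
    ½ * p + ½ * p     ≡⟨ halves p ⟩
    p                 ∎
    where
    pw-nonneg-like : 0ℚ ≤ ½ * p
    pw-nonneg-like = begin
      0ℚ      ≡⟨ sym (*-zeroʳ ½) ⟩
      ½ * 0ℚ  ≤⟨ *-monoˡ-≤-nonNeg ½ {{_}} 0≤p ⟩
      ½ * p   ∎

Φ-reg : ∀ α → Regular (Φseq α)
Φ-reg α n = begin
  ∣ Φseq α n - Φseq α (suc n) ∣    ≡⟨ cong (λ z → ∣ Φseq α n - z ∣) (step α n) ⟩
  ∣ A - (A + e * q) ∣              ≡⟨ cong ∣_∣ (solve 3 (λ a e q → a :- (a :+ e :* q) := :- (e :* q)) refl A e q) ⟩
  ∣ - (e * q) ∣                    ≡⟨ ∣-p∣≡∣p∣ (e * q) ⟩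
  ∣ e * q ∣                        ≡⟨ ∣p*q∣≡∣p∣*∣q∣ e q ⟩
  ∣ e ∣ * ∣ q ∣                    ≡⟨ cong (∣ e ∣ *_) (0≤p⇒∣p∣≡p (pw-nonneg (suc (suc n)))) ⟩
  ∣ e ∣ * q                        ≤⟨ *-monoʳ-≤-nonNeg q {{nonNegative (pw-nonneg (suc (suc n)))}} (digit-abs (α n)) ⟩
  1ℚ * q                           ≡⟨ *-identityˡ q ⟩
  q                                ≤⟨ half-le (pw (suc n)) (pw-nonneg (suc n)) ⟩
  pw (suc n)                       ∎
  where
  A = Φseq α n
  e = digit (α n)
  q = pw (suc (suc n))

private
  Φ-bounds : ∀ α n → (pw (suc n) ≤ Φseq α n) × (Φseq α n ≤ 1ℚ - pw (suc n))
  Φ-bounds α zero =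
    toWitness {a? = pw 1 ≤? Φseq α zero} _ , toWitness {a? = Φseq α zero ≤? 1ℚ - pw 1} _
  Φ-bounds α (suc n) = lo , hi
    where
    A = Φseq α n
    e = digit (α n)
    P = pw (suc n)
    q = pw (suc (suc n))
    q≥0 : 0ℚ ≤ q
    q≥0 = pw-nonneg (suc (suc n))
    P≡ : P ≡ q + q
    P≡ = sym (halves P)
    ih = Φ-bounds α n
    lo : q ≤ Φseq α (suc n)
    lo = begin
      q                  ≡⟨ solve 1 (λ q → q := (q :+ q) :+ con (- 1ℚ) :* q) refl q ⟩
      (q + q) + (- 1ℚ) * q  ≡⟨ cong (_+ (- 1ℚ) * q) (sym P≡) ⟩
      P + (- 1ℚ) * q     ≤⟨ +-mono-≤ (proj₁ ih) (*-monoʳ-≤-nonNeg q {{nonNegative q≥0}} (digit-lo (α n))) ⟩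
      A + e * q          ≡⟨ sym (step α n) ⟩
      Φseq α (suc n)     ∎
    hi : Φseq α (suc n) ≤ 1ℚ - q
    hi = begin
      Φseq α (suc n)     ≡⟨ step α n ⟩
      A + e * q          ≤⟨ +-mono-≤ (proj₂ ih) (*-monoʳ-≤-nonNeg q {{nonNegative q≥0}} (digit-hi (α n))) ⟩
      (1ℚ - P) + 1ℚ * q  ≡⟨ cong (λ z → (1ℚ - z) + 1ℚ * q) P≡ ⟩
      (1ℚ - (q + q)) + 1ℚ * q  ≡⟨ solve 1 (λ q → (con 1ℚ :- (q :+ q)) :+ con 1ℚ :* q := con 1ℚ :- q) refl q ⟩
      1ℚ - q             ∎

  one-minus : ∀ p → 0ℚ ≤ p → 1ℚ - p ≤ 1ℚ
  one-minus p 0≤p = begin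
    1ℚ - p          ≡⟨ sym (+-identityʳ (1ℚ - p)) ⟩
    (1ℚ - p) + 0ℚ   ≤⟨ +-monoʳ-≤ (1ℚ - p) 0≤p ⟩
    (1ℚ - p) + p    ≡⟨ solve 1 (λ p → (con 1ℚ :- p) :+ p := con 1ℚ) refl p ⟩
    1ℚ              ∎

Φ-unit : ∀ α n → (0ℚ ≤ Φseq α n) × (Φseq α n ≤ 1ℚ)
Φ-unit α n =
  ≤-trans (pw-nonneg (suc n)) (proj₁ (Φ-bounds α n)) ,
  ≤-trans (proj₂ (Φ-bounds α n)) (one-minus (pw (suc n)) (pw-nonneg (suc n)))

Φ : Ternary → I01
Φ α = mkI (Φseq α) (Φ-reg α) (Φ-unit α)

IsTernaryModulus : Fun → (ℕ → Ternary → ℕ) → Set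
IsTernaryModulus f g = ∀ k (α : Ternary) (x : I01) →
  DistLe (pt (Φ α)) (pt x) (pw (g k α)) →
  DistLe (seq (ap f (Φ α))) (seq (ap f x)) (pw k)

IsContinuousTernaryModulus : (ℕ → Ternary → ℕ) → Set
IsContinuousTernaryModulus g = ∀ k (α : Ternary) → ∃ λ m → ∀ (β : Ternary) →
  (∀ i → i <ℕ m → α i ≡ β i) → g k α ≡ g k β

UniformlyContinuous : Fun → Set
UniformlyContinuous f = ∃ λ (ω : ℕ → ℕ) → ∀ k (x y : I01) →
  DistLe (pt x) (pt y) (pw (ω k)) →
  DistLe (seq (ap f x)) (seq (ap f y)) (pw k)

UCTc : Set
UCTc = ∀ (f : Fun) (g : ℕ → I01 → ℕ) →
  IsModulus f g → IsContinuousModulus g → UniformlyContinuous f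

UCTc' : Set
UCTc' = ∀ (f : Fun) (g : ℕ → Ternary → ℕ) →
  IsTernaryModulus f g → IsContinuousTernaryModulus g → UniformlyContinuous f

module Submission where

-- A point x of [0,1] is turned continuously into a ternary sequence ψ x with Φ (ψ x) ≃ x: the
-- n-th digit moves the dyadic centre Φ (ψ x)ₙ by −2^{-(n+2)}, 0 or 2^{-(n+2)} after comparing it
-- with the rational x_{n+4}, which keeps x within 2^{-(n+1)} of the centre. As ψ x n only reads
-- x₀, …, x_{n+4}, a continuous ternary modulus g yields the continuous modulus x ↦ g_{k+2} (ψ x)
-- (plus one): g at ψ x controls both |f Φ(ψ x) − f x| and |f Φ(ψ x) − f y|. Conversely g ∘ Φ is a
-- continuous ternary modulus when g is a continuous modulus, because Φ(α)ₙ only reads α₀, …, α_{n−1}.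

open import Defs
open import Function.Bundles using (_⇔_; mk⇔)
open import Data.Nat as ℕ using (ℕ; zero; suc) renaming (_<_ to _<ℕ_)
import Data.Nat.Properties as ℕ
open import Data.Fin using (Fin; zero; suc)
open import Data.List using (_∷ʳ_)
open import Data.List.Properties using (foldl-∷ʳ)
import Data.Integer as ℤ
open import Data.Rational using (ℚ; 0ℚ; 1ℚ; ½; _+_; _*_; _-_; -_; ∣_∣; _≤_; _≤?_; _/_)
open import Data.Rational.Properties
open import Data.Rational.Solver using (module +-*-Solver)
open import Data.Product using (proj₁; proj₂; map; map₂)
open import Data.Sum using (inj₁; inj₂)
open import Relation.Binary.PropositionalEquality
open import Relation.Nullary using (yes; no)
open import Algebra.Properties.Group +-0-group using (⁻¹-involutive)

open +-*-Solver
open ≤-Reasoning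

p+r≡q⇒p≤q : ∀ {p q} r → 0ℚ ≤ r → p + r ≡ q → p ≤ q
p+r≡q⇒p≤q {p} r 0≤r refl = ≤-trans (≤-reflexive (sym (+-identityʳ p))) (+-monoʳ-≤ p 0≤r)

∣p∣≤q⇒p≤q : ∀ {p q} → ∣ p ∣ ≤ q → p ≤ q
∣p∣≤q⇒p≤q {p} ∣p∣≤q with ∣p∣≡p∨∣p∣≡-p p
... | inj₁ ∣p∣≡p  = subst (_≤ _) ∣p∣≡p ∣p∣≤q
... | inj₂ ∣p∣≡-p = ≤-trans p≤0 (≤-trans (0≤∣p∣ p) ∣p∣≤q)
  where
  p≤0 : p ≤ 0ℚ
  p≤0 = subst (_≤ 0ℚ) (⁻¹-involutive p) (neg-antimono-≤ (subst (0ℚ ≤_) ∣p∣≡-p (0≤∣p∣ p)))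

∣p∣≤q⇒-q≤p : ∀ {p q} → ∣ p ∣ ≤ q → - q ≤ p
∣p∣≤q⇒-q≤p {p} ∣p∣≤q =
  subst (_ ≤_) (⁻¹-involutive p) (neg-antimono-≤ (∣p∣≤q⇒p≤q (subst (_≤ _) (sym (∣-p∣≡∣p∣ p)) ∣p∣≤q)))

-q≤p≤q⇒∣p∣≤q : ∀ {p q} → - q ≤ p → p ≤ q → ∣ p ∣ ≤ q
-q≤p≤q⇒∣p∣≤q {p} {q} -q≤p p≤q with ∣p∣≡p∨∣p∣≡-p p
... | inj₁ ∣p∣≡p  = subst (_≤ q) (sym ∣p∣≡p) p≤q
... | inj₂ ∣p∣≡-p = subst₂ _≤_ (sym ∣p∣≡-p) (⁻¹-involutive q) (neg-antimono-≤ -q≤p)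

∣p-q∣≡∣q-p∣ : ∀ p q → ∣ p - q ∣ ≡ ∣ q - p ∣
∣p-q∣≡∣q-p∣ p q = trans (sym (∣-p∣≡∣p∣ (p - q))) (cong ∣_∣ (solve 2 (λ p q → :- (p :- q) := q :- p) refl p q))

∣p-r∣≤∣p-q∣+∣q-r∣ : ∀ p q r → ∣ p - r ∣ ≤ ∣ p - q ∣ + ∣ q - r ∣
∣p-r∣≤∣p-q∣+∣q-r∣ p q r = subst (_≤ ∣ p - q ∣ + ∣ q - r ∣)
  (cong ∣_∣ (solve 3 (λ p q r → (p :- q) :+ (q :- r) := p :- r) refl p q r))
  (∣p+q∣≤∣p∣+∣q∣ (p - q) (q - r))

pw-nonneg : ∀ n → 0ℚ ≤ pw n
pw-nonneg zero    = nonNegative⁻¹ 1ℚ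
pw-nonneg (suc n) = ≤-trans (≤-reflexive (sym (*-zeroʳ ½))) (*-monoˡ-≤-nonNeg ½ (pw-nonneg n))

pw-suc+pw-suc : ∀ n → pw (suc n) + pw (suc n) ≡ pw n
pw-suc+pw-suc n = solve 1 (λ p → con ½ :* p :+ con ½ :* p := p) refl (pw n)

pw-suc≤pw : ∀ n → pw (suc n) ≤ pw n
pw-suc≤pw n = p+r≡q⇒p≤q (pw (suc n)) (pw-nonneg (suc n)) (pw-suc+pw-suc n)

pw-antitone : ∀ {m n} → m ℕ.≤′ n → pw n ≤ pw m
pw-antitone ℕ.≤′-refl                    = ≤-refl
pw-antitone {n = suc n} (ℕ.≤′-step m≤′n) = ≤-trans (pw-suc≤pw n) (pw-antitone m≤′n)

module _ (r : ℕ → ℚ) (r-reg : Regular r) where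

  regular-tail : ∀ t n → ∣ r n - r (t ℕ.+ n) ∣ + pw (t ℕ.+ n) ≤ pw n
  regular-tail zero    n = ≤-reflexive (trans (cong (λ d → ∣ d ∣ + pw n) (+-inverseʳ (r n))) (+-identityˡ (pw n)))
  regular-tail (suc t) n = begin
    ∣ r n - r (suc k) ∣ + pw (suc k)
      ≤⟨ +-monoˡ-≤ (pw (suc k)) (∣p-r∣≤∣p-q∣+∣q-r∣ (r n) (r k) (r (suc k))) ⟩
    ∣ r n - r k ∣ + ∣ r k - r (suc k) ∣ + pw (suc k)
      ≤⟨ +-monoˡ-≤ (pw (suc k)) (+-monoʳ-≤ ∣ r n - r k ∣ (r-reg k)) ⟩
    ∣ r n - r k ∣ + pw (suc k) + pw (suc k)
      ≡⟨ +-assoc ∣ r n - r k ∣ (pw (suc k)) (pw (suc k)) ⟩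
    ∣ r n - r k ∣ + (pw (suc k) + pw (suc k))
      ≡⟨ cong (λ d → ∣ r n - r k ∣ + d) (pw-suc+pw-suc k) ⟩
    ∣ r n - r k ∣ + pw k
      ≤⟨ regular-tail t n ⟩
    pw n ∎
    where k = t ℕ.+ n

  regular-≤ : ∀ t n → ∣ r n - r (t ℕ.+ n) ∣ ≤ pw n
  regular-≤ t n = ≤-trans (p+r≡q⇒p≤q (pw (t ℕ.+ n)) (pw-nonneg (t ℕ.+ n)) refl) (regular-tail t n)

  regular-dist : ∀ m n → ∣ r m - r n ∣ ≤ pw m + pw n
  regular-dist m n with ℕ.≤-total m n
  ... | inj₁ m≤n = ≤-trans (subst (λ k → ∣ r m - r k ∣ ≤ pw m) (ℕ.m∸n+n≡m m≤n) (regular-≤ (n ℕ.∸ m) m))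
                           (p+r≡q⇒p≤q (pw n) (pw-nonneg n) refl)
  ... | inj₂ n≤m = subst₂ _≤_ (∣p-q∣≡∣q-p∣ (r n) (r m)) (+-comm (pw n) (pw m)) (≤-trans
                     (subst (λ k → ∣ r n - r k ∣ ≤ pw n) (ℕ.m∸n+n≡m n≤m) (regular-≤ (m ℕ.∸ n) n))
                     (p+r≡q⇒p≤q (pw m) (pw-nonneg m) refl))

DistLe-sym : ∀ {x y c} → DistLe x y c → DistLe y x c
DistLe-sym {x} {y} {c} x~y n = subst (_≤ c + pw n) (∣p-q∣≡∣q-p∣ (x (suc n)) (y (suc n))) (x~y n)

≃ₛ⇒DistLe : ∀ {x y c} → 0ℚ ≤ c → x ≃ₛ y → DistLe x y c
≃ₛ⇒DistLe {c = c} 0≤c x≃y n = ≤-trans (x≃y n) (p+r≡q⇒p≤q c 0≤c (+-comm (pw n) c))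

-- The comparison is made at the far index j + n + 2, where the regularity errors sum to pw j.
DistLe-trans : ∀ {x y z a b} → Regular x → Regular z → ∀ j →
  DistLe x y a → DistLe y z b → DistLe x z (a + b + pw j)
DistLe-trans {x} {y} {z} {a} {b} x-reg z-reg j x~y y~z n = begin
  ∣ x n′ - z n′ ∣
    ≤⟨ ∣p-r∣≤∣p-q∣+∣q-r∣ (x n′) (x K) (z n′) ⟩
  ∣ x n′ - x K ∣ + ∣ x K - z n′ ∣
    ≤⟨ +-monoʳ-≤ ∣ x n′ - x K ∣ (∣p-r∣≤∣p-q∣+∣q-r∣ (x K) (y K) (z n′)) ⟩
  ∣ x n′ - x K ∣ + (∣ x K - y K ∣ + ∣ y K - z n′ ∣)
    ≤⟨ +-monoʳ-≤ ∣ x n′ - x K ∣ (+-monoʳ-≤ ∣ x K - y K ∣ (∣p-r∣≤∣p-q∣+∣q-r∣ (y K) (z K) (z n′))) ⟩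
  ∣ x n′ - x K ∣ + (∣ x K - y K ∣ + (∣ y K - z K ∣ + ∣ z K - z n′ ∣))
    ≤⟨ +-mono-≤ (regular-≤ x x-reg t n′) (+-mono-≤ (x~y M) (+-mono-≤ (y~z M) z-tail)) ⟩
  pw n′ + ((a + pw M) + ((b + pw M) + pw n′))
    ≡⟨ solve 4 (λ a b P Q → Q :+ ((a :+ P) :+ ((b :+ P) :+ Q)) := a :+ b :+ (P :+ P) :+ (Q :+ Q))
         refl a b (pw M) (pw n′) ⟩
  a + b + (pw M + pw M) + (pw n′ + pw n′)
    ≡⟨ cong₂ (λ u v → a + b + u + v) (pw-suc+pw-suc (j ℕ.+ n′)) (pw-suc+pw-suc n) ⟩
  a + b + pw (j ℕ.+ n′) + pw n
    ≤⟨ +-monoˡ-≤ (pw n) (+-monoʳ-≤ (a + b) (pw-antitone (ℕ.m≤′m+n j n′))) ⟩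
  a + b + pw j + pw n ∎
  where
  n′ = suc n
  t  = suc (suc j)
  K  = t ℕ.+ n′
  M  = suc (j ℕ.+ n′)
  z-tail : ∣ z K - z n′ ∣ ≤ pw n′
  z-tail = subst (_≤ pw n′) (∣p-q∣≡∣q-p∣ (z n′) (z K)) (regular-≤ z z-reg t n′)

data Rounding (c t : ℚ) : ℚ → Set where
  up   : t ≤ c     → Rounding c t 1ℚ
  down : c ≤ - t   → Rounding c t (- 1ℚ)
  stay : ∣ c ∣ ≤ t → Rounding c t 0ℚ

roundDigit : ℚ → ℚ → Fin 3
roundDigit c t with t ≤? c | c ≤? - t
... | yes _ | _     = suc (suc zero)
... | no _  | yes _ = zero
... | no _  | no _  = suc zero

roundDigit-rounds : ∀ c t → Rounding c t (digit (roundDigit c t))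
roundDigit-rounds c t with t ≤? c | c ≤? - t
... | yes t≤c | _        = up t≤c
... | no _    | yes c≤-t = down c≤-t
... | no t≰c  | no c≰-t  = stay (-q≤p≤q⇒∣p∣≤q (<⇒≤ (≰⇒> c≰-t)) (<⇒≤ (≰⇒> t≰c)))

module _ {s p : ℚ} (0≤s : 0ℚ ≤ s) where

  0≤¼s : 0ℚ ≤ ½ * (½ * s)
  0≤¼s = *-monoˡ-≤-nonNeg ½ (*-monoˡ-≤-nonNeg ½ 0≤s)

  -- w = centre − x and e = approximant − x, both taken at the same index of x.
  rounding-up : ∀ {w e} → - (s + s + p) ≤ w → e ≤ ½ * (½ * s) + p → ½ * s ≤ e - w →
    ∣ w + 1ℚ * s ∣ ≤ s + p
  rounding-up {w} {e} w≥ e≤ c≥ = -q≤p≤q⇒∣p∣≤q lower upper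
    where
    upper : w + 1ℚ * s ≤ s + p
    upper = begin
      w + 1ℚ * s                         ≡⟨ solve 3 (λ w e s → w :+ con 1ℚ :* s := e :+ :- (e :- w) :+ s) refl w e s ⟩
      e + - (e - w) + s                  ≤⟨ +-monoˡ-≤ s (+-mono-≤ e≤ (neg-antimono-≤ c≥)) ⟩
      ½ * (½ * s) + p + - (½ * s) + s    ≤⟨ p+r≡q⇒p≤q (½ * (½ * s)) 0≤¼s
                                              (solve 2 (λ s p → con ½ :* (con ½ :* s) :+ p :+ :- (con ½ :* s) :+ s
                                                                  :+ con ½ :* (con ½ :* s) := s :+ p) refl s p) ⟩
      s + p                              ∎
    lower : - (s + p) ≤ w + 1ℚ * s
    lower = begin
      - (s + p)             ≡⟨ solve 2 (λ s p → :- (s :+ p) := :- (s :+ s :+ p) :+ s) refl s p ⟩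
      - (s + s + p) + s     ≤⟨ +-monoˡ-≤ s w≥ ⟩
      w + s                 ≡⟨ cong (w +_) (sym (*-identityˡ s)) ⟩
      w + 1ℚ * s            ∎

  rounding-step : ∀ {w e d} → ∣ w ∣ ≤ s + s + p → ∣ e ∣ ≤ ½ * (½ * s) + p →
    Rounding (e - w) (½ * s) d → ∣ w + d * s ∣ ≤ s + p
  rounding-step ∣w∣≤ ∣e∣≤ (up c≥) = rounding-up (∣p∣≤q⇒-q≤p ∣w∣≤) (∣p∣≤q⇒p≤q ∣e∣≤) c≥
  rounding-step {w} {e} ∣w∣≤ ∣e∣≤ (down c≤) =
    subst (_≤ s + p) reflect (rounding-up (neg-antimono-≤ (∣p∣≤q⇒p≤q ∣w∣≤)) (∣p∣≤q⇒p≤q ∣-e∣≤) c≥)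
    where
    ∣-e∣≤ : ∣ - e ∣ ≤ ½ * (½ * s) + p
    ∣-e∣≤ = subst (_≤ ½ * (½ * s) + p) (sym (∣-p∣≡∣p∣ e)) ∣e∣≤
    c≥ : ½ * s ≤ - e - - w
    c≥ = subst₂ _≤_ (⁻¹-involutive (½ * s)) (solve 2 (λ e w → :- (e :- w) := :- e :- :- w) refl e w)
           (neg-antimono-≤ c≤)
    reflect : ∣ - w + 1ℚ * s ∣ ≡ ∣ w + - 1ℚ * s ∣
    reflect = trans (sym (∣-p∣≡∣p∣ (- w + 1ℚ * s)))
                (cong ∣_∣ (solve 2 (λ w s → :- (:- w :+ con 1ℚ :* s) := w :+ con (- 1ℚ) :* s) refl w s))
  rounding-step {w} {e} ∣w∣≤ ∣e∣≤ (stay ∣c∣≤) = begin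
    ∣ w + 0ℚ * s ∣               ≡⟨ cong ∣_∣ (solve 3 (λ w e s → w :+ con 0ℚ :* s := e :- (e :- w)) refl w e s) ⟩
    ∣ e - (e - w) ∣              ≤⟨ ∣p-q∣≤∣p∣+∣q∣ e (e - w) ⟩
    ∣ e ∣ + ∣ e - w ∣            ≤⟨ +-mono-≤ ∣e∣≤ ∣c∣≤ ⟩
    ½ * (½ * s) + p + ½ * s      ≤⟨ p+r≡q⇒p≤q (½ * (½ * s)) 0≤¼s
                                      (solve 2 (λ s p → con ½ :* (con ½ :* s) :+ p :+ con ½ :* s
                                                          :+ con ½ :* (con ½ :* s) := s :+ p) refl s p) ⟩
    s + p                        ∎

Φseq-suc : ∀ α n → Φseq α (suc n) ≡ Φseq α n + digit (α n) * pw (2 ℕ.+ n)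
Φseq-suc α n = begin-equality
  Φseq α (suc n)                              ≡⟨ cong (pw (2 ℕ.+ n) *_) (foldl-∷ʳ _ 1ℚ (α n) (initSeg α n)) ⟩
  pw (2 ℕ.+ n) * (two * N (initSeg α n) + d)  ≡⟨ solve 3 (λ P a d → (con ½ :* (con ½ :* P)) :* (con two :* a :+ d)
                                                   := (con ½ :* P) :* a :+ d :* (con ½ :* (con ½ :* P)))
                                                   refl (pw n) (N (initSeg α n)) d ⟩
  Φseq α n + d * pw (2 ℕ.+ n)                 ∎
  where
  two = ℤ.+ 2 / 1
  d   = digit (α n)

∣½-p∣≤½ : ∀ {p} → 0ℚ ≤ p → p ≤ 1ℚ → ∣ ½ - p ∣ ≤ ½
∣½-p∣≤½ {p} 0≤p p≤1 = -q≤p≤q⇒∣p∣≤q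
  (p+r≡q⇒p≤q (1ℚ - p) (≤-trans (≤-reflexive (sym (+-inverseʳ p))) (+-monoˡ-≤ (- p) p≤1))
    (solve 1 (λ p → :- con ½ :+ (con 1ℚ :- p) := con ½ :- p) refl p))
  (p+r≡q⇒p≤q p 0≤p (solve 1 (λ p → con ½ :- p :+ p := con ½) refl p))

Rounds : I01 → Ternary → Set
Rounds x α = ∀ n → Rounding (pt x (4 ℕ.+ n) - Φseq α n) (pw (3 ℕ.+ n)) (digit (α n))

rounds⇒dist : ∀ x α → Rounds x α → ∀ n m → ∣ Φseq α n - pt x m ∣ ≤ pw (suc n) + pw m
rounds⇒dist x α ρ zero m =
  ≤-trans (∣½-p∣≤½ (proj₁ (pt-unit x m)) (proj₂ (pt-unit x m))) (p+r≡q⇒p≤q (pw m) (pw-nonneg m) refl)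
rounds⇒dist x α ρ (suc n) m = begin
  ∣ Φseq α (suc n) - X ∣        ≡⟨ cong ∣_∣ (trans (cong (_- X) (Φseq-suc α n))
                                     (solve 4 (λ v d s X → v :+ d :* s :- X := (v :- X) :+ d :* s) refl v d s X)) ⟩
  ∣ (v - X) + d * s ∣           ≤⟨ rounding-step (pw-nonneg (2 ℕ.+ n)) ∣w∣≤ (regular-dist (pt x) (pt-reg x) (4 ℕ.+ n) m)
                                     (subst (λ c → Rounding c (pw (3 ℕ.+ n)) d)
                                       (solve 3 (λ q v X → q :- v := (q :- X) :- (v :- X)) refl q v X) (ρ n)) ⟩
  s + pw m                      ∎
  where
  X = pt x m
  v = Φseq α n
  q = pt x (4 ℕ.+ n)
  d = digit (α n)
  s = pw (2 ℕ.+ n)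
  ∣w∣≤ : ∣ v - X ∣ ≤ s + s + pw m
  ∣w∣≤ = subst (λ b → ∣ v - X ∣ ≤ b + pw m) (sym (pw-suc+pw-suc (suc n))) (rounds⇒dist x α ρ n m)

rounds⇒≃ : ∀ x α → Rounds x α → Φseq α ≃ₛ pt x
rounds⇒≃ x α ρ n = ≤-trans (rounds⇒dist x α ρ (suc n) (suc n))
  (p+r≡q⇒p≤q (pw (2 ℕ.+ n)) (pw-nonneg (2 ℕ.+ n))
    (solve 1 (λ P → con ½ :* (con ½ :* P) :+ con ½ :* P :+ con ½ :* (con ½ :* P) := P) refl (pw n)))

-- centre x n is Φseq (ψ x) n, computed alongside ψ so that the recursion is structural.
mutual
  ψ : I01 → Ternary
  ψ x n = roundDigit (pt x (4 ℕ.+ n) - centre x n) (pw (3 ℕ.+ n))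

  centre : I01 → ℕ → ℚ
  centre x zero    = ½
  centre x (suc n) = centre x n + digit (ψ x n) * pw (2 ℕ.+ n)

Φseq∘ψ≡centre : ∀ x n → Φseq (ψ x) n ≡ centre x n
Φseq∘ψ≡centre x zero    = refl
Φseq∘ψ≡centre x (suc n) =
  trans (Φseq-suc (ψ x) n) (cong (λ v → v + digit (ψ x n) * pw (2 ℕ.+ n)) (Φseq∘ψ≡centre x n))

ψ-rounds : ∀ x → Rounds x (ψ x)
ψ-rounds x n = subst (λ v → Rounding (pt x (4 ℕ.+ n) - v) (pw (3 ℕ.+ n)) (digit (ψ x n)))
  (sym (Φseq∘ψ≡centre x n)) (roundDigit-rounds _ _)

Φ∘ψ≃id : ∀ x → Φseq (ψ x) ≃ₛ pt x
Φ∘ψ≃id x = rounds⇒≃ x (ψ x) (ψ-rounds x)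

mutual
  centre-cong : ∀ x y n → (∀ i → i <ℕ 4 ℕ.+ n → pt x i ≡ pt y i) → centre x n ≡ centre y n
  centre-cong x y zero    x≡y = refl
  centre-cong x y (suc n) x≡y = cong₂ (λ v d → v + digit d * pw (2 ℕ.+ n))
    (centre-cong x y n (λ i i< → x≡y i (ℕ.m<n⇒m<1+n i<))) (ψ-cong x y n x≡y)

  ψ-cong : ∀ x y n → (∀ i → i <ℕ 5 ℕ.+ n → pt x i ≡ pt y i) → ψ x n ≡ ψ y n
  ψ-cong x y n x≡y = cong₂ (λ q v → roundDigit (q - v) (pw (3 ℕ.+ n)))
    (x≡y (4 ℕ.+ n) (ℕ.n<1+n _)) (centre-cong x y n (λ i i< → x≡y i (ℕ.m<n⇒m<1+n i<)))

Φ∘ψ-DistLe : ∀ x y G → DistLe (pt x) (pt y) (pw (suc G)) → DistLe (Φseq (ψ x)) (pt y) (pw G)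
Φ∘ψ-DistLe x y G x~y = subst (DistLe (Φseq (ψ x)) (pt y)) 0+pw-suc+pw-suc
  (DistLe-trans {Φseq (ψ x)} {pt x} {pt y} {0ℚ} {pw (suc G)} (Φ-reg (ψ x)) (pt-reg y) (suc G)
    (≃ₛ⇒DistLe {Φseq (ψ x)} {pt x} {0ℚ} ≤-refl (Φ∘ψ≃id x)) x~y)
  where
  0+pw-suc+pw-suc : 0ℚ + pw (suc G) + pw (suc G) ≡ pw G
  0+pw-suc+pw-suc = trans (cong (_+ pw (suc G)) (+-identityˡ (pw (suc G)))) (pw-suc+pw-suc G)

initSeg-cong : ∀ {α β : Ternary} n → (∀ i → i <ℕ n → α i ≡ β i) → initSeg α n ≡ initSeg β n
initSeg-cong zero    α≡β = refl
initSeg-cong (suc n) α≡β = cong₂ _∷ʳ_ (initSeg-cong n (λ i i< → α≡β i (ℕ.m<n⇒m<1+n i<))) (α≡β n (ℕ.n<1+n n))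

Φseq-cong : ∀ {α β : Ternary} m → (∀ i → i <ℕ m → α i ≡ β i) → ∀ n → n <ℕ m → Φseq α n ≡ Φseq β n
Φseq-cong m α≡β n n<m = cong (λ s → pw (suc n) * N s) (initSeg-cong n (λ i i<n → α≡β i (ℕ.<-trans i<n n<m)))

UCTc⇒UCTc′ : UCTc → UCTc'
UCTc⇒UCTc′ uct f g g-mod g-cont = uct f g′ g′-mod g′-cont
  where
  g′ : ℕ → I01 → ℕ
  g′ k x = suc (g (2 ℕ.+ k) (ψ x))

  g′-mod : IsModulus f g′
  g′-mod k x y x~y = subst (DistLe fx fy) pw-k
    (DistLe-trans {fx} {fΦψx} {fy} {pw (2 ℕ.+ k)} {pw (2 ℕ.+ k)} (reg (ap f x)) (reg (ap f y)) (suc k)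
      (DistLe-sym {fΦψx} {fx} {pw (2 ℕ.+ k)} fΦψx~fx) fΦψx~fy)
    where
    fx    = seq (ap f x)
    fy    = seq (ap f y)
    fΦψx  = seq (ap f (Φ (ψ x)))
    G     = g (2 ℕ.+ k) (ψ x)
    fΦψx~fx : DistLe fΦψx fx (pw (2 ℕ.+ k))
    fΦψx~fx = g-mod (2 ℕ.+ k) (ψ x) x (≃ₛ⇒DistLe {Φseq (ψ x)} {pt x} {pw G} (pw-nonneg G) (Φ∘ψ≃id x))
    fΦψx~fy : DistLe fΦψx fy (pw (2 ℕ.+ k))
    fΦψx~fy = g-mod (2 ℕ.+ k) (ψ x) y (Φ∘ψ-DistLe x y G x~y)
    pw-k : pw (2 ℕ.+ k) + pw (2 ℕ.+ k) + pw (suc k) ≡ pw k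
    pw-k = trans (cong (_+ pw (suc k)) (pw-suc+pw-suc (suc k))) (pw-suc+pw-suc k)

  g′-cont : IsContinuousModulus g′
  g′-cont k x = map (4 ℕ.+_) (λ {m} g-const y x≡y → cong suc (g-const (ψ y) (λ i i<m →
    ψ-cong x y i (λ j j< → x≡y j (ℕ.<-≤-trans j< (ℕ.+-monoʳ-≤ 4 i<m))))))
    (g-cont (2 ℕ.+ k) (ψ x))

UCTc′⇒UCTc : UCTc' → UCTc
UCTc′⇒UCTc uct′ f g g-mod g-cont = uct′ f (λ k α → g k (Φ α)) (λ k α → g-mod k (Φ α)) g∘Φ-cont
  where
  g∘Φ-cont : IsContinuousTernaryModulus (λ k α → g k (Φ α))
  -- Not by with-abstraction: that normalises Φ α, including its costly regularity proofs.
  g∘Φ-cont k α = map₂ (λ {m} g-const β α≡β → g-const (Φ β) (Φseq-cong {α} {β} m α≡β)) (g-cont k (Φ α))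

theorem5p5 : UCTc ⇔ UCTc'
theorem5p5 = mk⇔ UCTc⇒UCTc′ UCTc′⇒UCTc
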